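{- Let $(n_j,k_j)_{j\geqslant 1}$ be a sequence of pairs of integers with $n_j\geqslant k_j\geqslant 3$ for all $j$ and $n_j\to\infty$. Then $k_j\cdot{\rm MMS}(n_j,k_j)/{\rm MMS}(n_j+k_j,k_j)$ does not tend to $1$ as $j\to\infty$.
   Context: For integers $n\geqslant k\geqslant 1$, $c$ and $r$ denote the unique integers with $n=ck+r$ and $r\in\{0,\ldots,k-1\}$, and ${\rm MMS}(n,k)=\binom{n}{c}\big/\big(k-r+\frac{r(c+1)}{n-c}\big)$ (with $c,r$ computed from the pair $(n,k)$ in question). -}

module Defs where

open import Data.Nat as ℕ using (ℕ; zero; suc; _∸_)
open import Data.Nat.DivMod using (_/_; _%_)
open import Data.Nat.Combinatorics using (_C_)
open import Data.Integer using (+_)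
open import Data.Rational as ℚ using (ℚ; 0ℚ; _÷_; _+_; _*_; ≢-nonZero)
open import Data.Rational.Properties using (_≟_)
open import Relation.Nullary using (yes; no)

ℕ→ℚ : ℕ → ℚ
ℕ→ℚ m = (+ m) ℚ./ 1

-- total division on ℚ: p ÷₀ q = p ÷ q when q ≠ 0, and 0 when q = 0
-- (the convention is never used in the statement: all divisors there are nonzero)
_÷₀_ : ℚ → ℚ → ℚ
p ÷₀ q with q ≟ 0ℚ
... | yes _ = 0ℚ
... | no q≢0 = _÷_ p q {{≢-nonZero q≢0}}

-- MMS(n,k) = binom(n,c) / (k - r + r(c+1)/(n-c)),  n = c k + r,  0 ≤ r < k.
-- (k = 0 is outside the definition's range; we set MMS n 0 = 0.)
MMS : ℕ → ℕ → ℚ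
MMS n zero = 0ℚ
MMS n k@(suc _) =
  ℕ→ℚ (n C c) ÷₀ (ℕ→ℚ (k ∸ r) + (ℕ→ℚ (r ℕ.* (c ℕ.+ 1)) ÷₀ ℕ→ℚ (n ∸ c)))
  where
    c = n / k
    r = n % k

-- Write n = c k + r.  Then n + k = (c + 1) k + r, so MMS (n + k) k has the same remainder
-- and quotient c + 1, and its denominator k − r + r(c+2)/(n+k−c−1) is at most the
-- denominator k − r + r(c+1)/(n−c) of MMS n k because r ≤ k − 1.  Hence k·MMS(n,k)/MMS(n+k,k) is at most
-- k·C(n,c) / C(n+k,c+1).  Since C(n+k,c+1) ≥ C(n,c+1) + k·C(n,c) and
-- C(n,c+1) = C(n,c)(n−c)/(c+1) ≥ k·C(n,c)/3 for k ≥ 3, c ≥ 1, the ratio is at most 3/4 for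
-- every n ≥ k ≥ 3.

module Submission where

open import Defs

module Binomial where
  open import Data.Nat
  open import Data.Nat.Properties
  open import Data.Nat.Combinatorics using (_C_; nC1≡n; nCk+nC[k+1]≡[n+1]C[k+1])
  open import Data.Nat.Tactic.RingSolver using (solve)
  open import Data.List.Base using (_∷_; [])
  open import Relation.Binary.PropositionalEquality

  [k+1]*[n+1]C[k+1]≡[n+1]*nCk : ∀ n k → suc k * (suc n C suc k) ≡ suc n * (n C k)
  [k+1]*[n+1]C[k+1]≡[n+1]*nCk zero    zero    = refl
  [k+1]*[n+1]C[k+1]≡[n+1]*nCk zero    (suc k) = *-zeroʳ (suc (suc k))
  [k+1]*[n+1]C[k+1]≡[n+1]*nCk (suc n) zero    =
    trans (+-identityʳ _) (trans (nC1≡n (suc (suc n))) (sym (*-identityʳ _)))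
  [k+1]*[n+1]C[k+1]≡[n+1]*nCk (suc n) (suc k) = begin
    suc (suc k) * (suc (suc n) C suc (suc k))
      ≡⟨ cong (suc (suc k) *_) (sym (nCk+nC[k+1]≡[n+1]C[k+1] (suc n) (suc k))) ⟩
    suc (suc k) * (suc n C suc k + suc n C suc (suc k))
      ≡⟨ pascal-step (suc n C suc k) (suc n C suc (suc k)) (n C k) (n C suc k)
           ([k+1]*[n+1]C[k+1]≡[n+1]*nCk n k) ([k+1]*[n+1]C[k+1]≡[n+1]*nCk n (suc k))
           (nCk+nC[k+1]≡[n+1]C[k+1] n k) ⟩
    suc (suc n) * (suc n C suc k) ∎
    where
    open ≡-Reasoning
    pascal-step : ∀ X Y p q → suc k * X ≡ suc n * p → suc (suc k) * Y ≡ suc n * q → p + q ≡ X →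
                  suc (suc k) * (X + Y) ≡ suc (suc n) * X
    pascal-step X Y p q eX eY p+q≡X = begin
      suc (suc k) * (X + Y)           ≡⟨ solve (k ∷ X ∷ Y ∷ []) ⟩
      X + suc k * X + suc (suc k) * Y ≡⟨ cong₂ (λ a b → X + a + b) eX eY ⟩
      X + suc n * p + suc n * q       ≡⟨ solve (n ∷ X ∷ p ∷ q ∷ []) ⟩
      X + suc n * (p + q)             ≡⟨ cong (λ z → X + suc n * z) p+q≡X ⟩
      X + suc n * X                   ≡⟨ solve (n ∷ X ∷ []) ⟩
      suc (suc n) * X                 ∎

  nCk>0 : ∀ {n k} → k ≤ n → 0 < n C k
  nCk>0 {n}     {zero}  _         = s≤s z≤n
  nCk>0 {suc n} {suc k} (s≤s k≤n) = <-≤-trans (nCk>0 k≤n)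
    (≤-trans (m≤m+n _ _) (≤-reflexive (nCk+nC[k+1]≡[n+1]C[k+1] n k)))

  nCk≤[n+1]Ck : ∀ n k → n C k ≤ suc n C k
  nCk≤[n+1]Ck n zero    = ≤-refl
  nCk≤[n+1]Ck n (suc k) = ≤-trans (m≤n+m _ _) (≤-reflexive (nCk+nC[k+1]≡[n+1]C[k+1] n k))

  nCk≤[n+t]Ck : ∀ n t k → n C k ≤ (n + t) C k
  nCk≤[n+t]Ck n zero    k = ≤-reflexive (cong (_C k) (sym (+-identityʳ n)))
  nCk≤[n+t]Ck n (suc t) k = begin
    n C k             ≤⟨ nCk≤[n+t]Ck n t k ⟩
    (n + t) C k       ≤⟨ nCk≤[n+1]Ck (n + t) k ⟩
    suc (n + t) C k   ≡⟨ cong (_C k) (sym (+-suc n t)) ⟩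
    (n + suc t) C k   ∎
    where open ≤-Reasoning

  t*nCk+nC[k+1]≤[n+t]C[k+1] : ∀ n t k → t * (n C k) + n C suc k ≤ (n + t) C suc k
  t*nCk+nC[k+1]≤[n+t]C[k+1] n zero    k = ≤-reflexive (cong (_C suc k) (sym (+-identityʳ n)))
  t*nCk+nC[k+1]≤[n+t]C[k+1] n (suc t) k = begin
    (n C k + t * (n C k)) + n C suc k   ≡⟨ +-assoc (n C k) _ _ ⟩
    n C k + (t * (n C k) + n C suc k)   ≤⟨ +-mono-≤ (nCk≤[n+t]Ck n t k) (t*nCk+nC[k+1]≤[n+t]C[k+1] n t k) ⟩
    (n + t) C k + (n + t) C suc k       ≡⟨ nCk+nC[k+1]≡[n+1]C[k+1] (n + t) k ⟩
    suc (n + t) C suc k                 ≡⟨ cong (_C suc k) (sym (+-suc n t)) ⟩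
    (n + suc t) C suc k                 ∎
    where open ≤-Reasoning

  k*nCc≤s*nC[c+1] : ∀ {k s n c} → (k + s) * suc c ≤ s * suc n → k * (n C c) ≤ s * (n C suc c)
  k*nCc≤s*nC[c+1] {k} {s} {n} {c} h = cancel (n C c) (n C suc c) (begin-equality
    suc n * (n C c)                  ≡⟨ sym ([k+1]*[n+1]C[k+1]≡[n+1]*nCk n c) ⟩
    suc c * (suc n C suc c)          ≡⟨ cong (suc c *_) (sym (nCk+nC[k+1]≡[n+1]C[k+1] n c)) ⟩
    suc c * (n C c + n C suc c)      ∎)
    where
    open ≤-Reasoning
    cancel : ∀ A B → suc n * A ≡ suc c * (A + B) → k * A ≤ s * B
    cancel A B e = *-cancelˡ-≤ (suc c) (+-cancelʳ-≤ (s * (suc c * A)) _ _ (begin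
      suc c * (k * A) + s * (suc c * A)   ≡⟨ solve (k ∷ s ∷ c ∷ A ∷ []) ⟩
      (k + s) * suc c * A                 ≤⟨ *-monoˡ-≤ A h ⟩
      s * suc n * A                       ≡⟨ *-assoc s (suc n) A ⟩
      s * (suc n * A)                     ≡⟨ cong (s *_) e ⟩
      s * (suc c * (A + B))               ≡⟨ solve (s ∷ c ∷ A ∷ B ∷ []) ⟩
      suc c * (s * B) + s * (suc c * A)   ∎))

  4*[k*nCc]≤3*[n+k]C[c+1] : ∀ {n k c} → (k + 3) * suc c ≤ 3 * suc n → 4 * (k * (n C c)) ≤ 3 * ((n + k) C suc c)
  4*[k*nCc]≤3*[n+k]C[c+1] {n} {k} {c} h = begin
    4 * (k * (n C c))                     ≡⟨ +-comm (k * (n C c)) _ ⟩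
    3 * (k * (n C c)) + k * (n C c)       ≤⟨ +-monoʳ-≤ (3 * (k * (n C c))) (k*nCc≤s*nC[c+1] {k} {3} {n} {c} h) ⟩
    3 * (k * (n C c)) + 3 * (n C suc c)   ≡⟨ sym (*-distribˡ-+ 3 (k * (n C c)) _) ⟩
    3 * (k * (n C c) + n C suc c)         ≤⟨ *-monoʳ-≤ 3 (t*nCk+nC[k+1]≤[n+t]C[k+1] n k c) ⟩
    3 * ((n + k) C suc c)                 ∎
    where open ≤-Reasoning

module Quotient where
  open import Data.Nat
  open import Data.Nat.Properties
  open import Data.Nat.Tactic.RingSolver using (solve)
  open import Data.List.Base using (_∷_; [])
  open import Data.Product using (_,_)
  open import Relation.Binary.PropositionalEquality

  [k+3]*[1+c]≤3*[1+n] : ∀ {n k c r} → 3 ≤ k → 1 ≤ c → n ≡ r + c * k → (k + 3) * suc c ≤ 3 * suc n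
  [k+3]*[1+c]≤3*[1+n] {k = suc (suc (suc a))} {suc b} {r} (s≤s (s≤s (s≤s _))) (s≤s _) refl = begin
    (3 + a + 3) * (2 + b)                                         ≤⟨ m≤m+n _ _ ⟩
    (3 + a + 3) * (2 + b) + (3 * r + 3 * b + a + 2 * a * b)       ≡⟨ solve (a ∷ b ∷ r ∷ []) ⟩
    3 * suc (r + suc b * (3 + a))                                 ∎
    where open ≤-Reasoning

  n∸c≡r+c*d : ∀ {n d c r} → n ≡ r + c * suc d → n ∸ c ≡ r + c * d
  n∸c≡r+c*d {d = d} {c} {r} refl = begin
    r + c * suc d ∸ c     ≡⟨ cong (_∸ c) (solve (r ∷ c ∷ d ∷ [])) ⟩
    r + c * d + c ∸ c     ≡⟨ m+n∸n≡m (r + c * d) c ⟩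
    r + c * d             ∎
    where open ≡-Reasoning

  1≤n∸c : ∀ {n d c r} → n ≡ r + c * suc d → 1 ≤ c → 1 ≤ d → 1 ≤ n ∸ c
  1≤n∸c {n} {d} {c} {r} n≡ 1≤c 1≤d =
    subst (1 ≤_) (sym (n∸c≡r+c*d {n} {d} {c} {r} n≡)) (≤-trans (*-mono-≤ 1≤c 1≤d) (m≤n+m (c * d) r))

  n+k≡r+[1+c]*k : ∀ {n k c r} → n ≡ r + c * k → n + k ≡ r + suc c * k
  n+k≡r+[1+c]*k {k = k} {c} {r} refl = solve (r ∷ c ∷ k ∷ [])

  r*[c+2]*[r+c*d]≤r*[c+1]*[r+[c+1]*d] : ∀ {r d} c → r ≤ d →
    r * (suc c + 1) * (r + c * d) ≤ r * (c + 1) * (r + suc c * d)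
  r*[c+2]*[r+c*d]≤r*[c+1]*[r+[c+1]*d] {r} c r≤d with m≤n⇒∃[o]m+o≡n r≤d
  ... | e , refl = begin
    r * (suc c + 1) * (r + c * (r + e))                  ≤⟨ m≤m+n _ (r * e) ⟩
    r * (suc c + 1) * (r + c * (r + e)) + r * e          ≡⟨ solve (r ∷ c ∷ e ∷ []) ⟩
    r * (c + 1) * (r + suc c * (r + e))                  ∎
    where open ≤-Reasoning

open import Data.Nat as ℕ using (ℕ; suc; s≤s; z≤n)
import Data.Nat.Properties as ℕ
open import Data.Nat.DivMod using (_%_; m≡m%n+[m/n]*n; m%n<n; m≥n⇒m/n>0; m/n≡1+[m∸n]/n; [m+n]%n≡m%n)
open import Data.Nat.Combinatorics using (_C_)
open import Data.Integer as ℤ using (+_; +≤+; +<+)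
import Data.Integer.Properties as ℤ
open import Data.Product using (_×_; ∃-syntax; _,_; proj₁; proj₂)
open import Data.Rational as ℚ using (ℚ; 0ℚ; 1ℚ; _/_; _+_; _*_; _-_; -_; ∣_∣; _≤_; _<_; *<*; 1/_; toℚᵘ; positive; nonNegative; ≢-nonZero)
open import Data.Rational.Properties
import Data.Rational.Unnormalised as ℚᵘ
import Data.Rational.Unnormalised.Properties as ℚᵘ
open import Data.Rational.Solver using (module +-*-Solver)
open import Data.Sum using (inj₁; inj₂)
open import Relation.Binary.PropositionalEquality
open import Relation.Nullary using (¬_; yes; no; contradiction)

toℚᵘ-ℕ→ℚ : ∀ m → toℚᵘ (ℕ→ℚ m) ℚᵘ.≃ ℚᵘ.mkℚᵘ (+ m) 0
toℚᵘ-ℕ→ℚ m = toℚᵘ-fromℚᵘ (ℚᵘ.mkℚᵘ (+ m) 0)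

ℕ→ℚ-mono-≤ : ∀ {m n} → m ℕ.≤ n → ℕ→ℚ m ≤ ℕ→ℚ n
ℕ→ℚ-mono-≤ {m} {n} m≤n = toℚᵘ-cancel-≤
  (ℚᵘ.≤-respˡ-≃ (ℚᵘ.≃-sym (toℚᵘ-ℕ→ℚ m)) (ℚᵘ.≤-respʳ-≃ (ℚᵘ.≃-sym (toℚᵘ-ℕ→ℚ n))
    (ℚᵘ.*≤* (ℤ.*-monoʳ-≤-nonNeg (+ 1) (+≤+ m≤n)))))

ℕ→ℚ-homo-* : ∀ m n → ℕ→ℚ (m ℕ.* n) ≡ ℕ→ℚ m * ℕ→ℚ n
ℕ→ℚ-homo-* m n = toℚᵘ-injective (ℚᵘ.≃-trans (toℚᵘ-ℕ→ℚ (m ℕ.* n)) (ℚᵘ.≃-sym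
  (ℚᵘ.≃-trans (toℚᵘ-homo-* (ℕ→ℚ m) (ℕ→ℚ n))
    (ℚᵘ.≃-trans (ℚᵘ.*-cong (toℚᵘ-ℕ→ℚ m) (toℚᵘ-ℕ→ℚ n)) (ℚᵘ.*≡* (cong (ℤ._* + 1) (sym (ℤ.pos-* m n))))))))

ℕ→ℚ-nonNeg : ∀ m → 0ℚ ≤ ℕ→ℚ m
ℕ→ℚ-nonNeg m = ℕ→ℚ-mono-≤ {0} {m} ℕ.z≤n

ℕ→ℚ-pos : ∀ {m} → 1 ℕ.≤ m → 0ℚ < ℕ→ℚ m
ℕ→ℚ-pos {m} 1≤m = <-≤-trans (*<* (+<+ (ℕ.s≤s ℕ.z≤n))) (ℕ→ℚ-mono-≤ {1} {m} 1≤m)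

÷₀-*-cancelʳ : ∀ p {q} → 0ℚ < q → (p ÷₀ q) * q ≡ p
÷₀-*-cancelʳ p {q} 0<q with q ≟ 0ℚ
... | yes q≡0 = contradiction (sym q≡0) (<⇒≢ 0<q)
... | no q≢0 = trans (*-assoc p (1/ q) q) (trans (cong (p *_) (*-inverseˡ q)) (*-identityʳ p))
  where instance _ = ≢-nonZero q≢0

*-÷₀-assoc : ∀ p q r → p * (q ÷₀ r) ≡ (p * q) ÷₀ r
*-÷₀-assoc p q r with r ≟ 0ℚ
... | yes _ = *-zeroʳ p
... | no r≢0 = sym (*-assoc p q (1/ r))
  where instance _ = ≢-nonZero r≢0

≤*⇒÷₀≤ : ∀ {p q s} → 0ℚ < q → p ≤ s * q → p ÷₀ q ≤ s
≤*⇒÷₀≤ {p} {q} 0<q p≤sq =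
  *-cancelʳ-≤-pos q {{positive 0<q}} (subst (_≤ _) (sym (÷₀-*-cancelʳ p 0<q)) p≤sq)

*≤⇒≤÷₀ : ∀ {p q s} → 0ℚ < q → s * q ≤ p → s ≤ p ÷₀ q
*≤⇒≤÷₀ {p} {q} 0<q sq≤p =
  *-cancelʳ-≤-pos q {{positive 0<q}} (subst (_ ≤_) (sym (÷₀-*-cancelʳ p 0<q)) sq≤p)

÷₀-nonNeg : ∀ {p q} → 0ℚ ≤ p → 0ℚ < q → 0ℚ ≤ p ÷₀ q
÷₀-nonNeg {p} {q} 0≤p 0<q = *≤⇒≤÷₀ 0<q (subst (_≤ p) (sym (*-zeroˡ q)) 0≤p)

÷₀-pos : ∀ {p q} → 0ℚ < p → 0ℚ < q → 0ℚ < p ÷₀ q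
÷₀-pos {p} {q} 0<p 0<q = *-cancelʳ-<-nonNeg q {{nonNegative (<⇒≤ 0<q)}}
  (subst₂ _<_ (sym (*-zeroˡ q)) (sym (÷₀-*-cancelʳ p 0<q)) 0<p)

*≤*⇒÷₀≤÷₀ : ∀ {p q r s} → 0ℚ < q → 0ℚ < s → p * s ≤ r * q → p ÷₀ q ≤ r ÷₀ s
*≤*⇒÷₀≤÷₀ {p} {q} {r} {s} 0<q 0<s ps≤rq = ≤*⇒÷₀≤ 0<q (*-cancelʳ-≤-pos s {{positive 0<s}} (begin
  p * s                  ≤⟨ ps≤rq ⟩
  r * q                  ≡⟨ cong (_* q) (sym (÷₀-*-cancelʳ r 0<s)) ⟩
  r ÷₀ s * s * q         ≡⟨ *-assoc (r ÷₀ s) s q ⟩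
  r ÷₀ s * (s * q)       ≡⟨ cong (r ÷₀ s *_) (*-comm s q) ⟩
  r ÷₀ s * (q * s)       ≡⟨ sym (*-assoc (r ÷₀ s) q s) ⟩
  r ÷₀ s * q * s         ∎))
  where open ≤-Reasoning

÷₀-÷₀-≤ : ∀ {a b D D′} → 0ℚ ≤ a → 0ℚ < b → 0ℚ < D′ → D′ ≤ D → (a ÷₀ D) ÷₀ (b ÷₀ D′) ≤ a ÷₀ b
÷₀-÷₀-≤ {a} {b} {D} {D′} 0≤a 0<b 0<D′ D′≤D = ≤*⇒÷₀≤ (÷₀-pos 0<b 0<D′) (begin
  a ÷₀ D                 ≤⟨ *≤*⇒÷₀≤÷₀ (<-≤-trans 0<D′ D′≤D) 0<D′ (*-monoˡ-≤-nonNeg a {{nonNegative 0≤a}} D′≤D) ⟩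
  a ÷₀ D′                ≡⟨ cong (_÷₀ D′) (sym (÷₀-*-cancelʳ a 0<b)) ⟩
  (a ÷₀ b * b) ÷₀ D′     ≡⟨ sym (*-÷₀-assoc (a ÷₀ b) b D′) ⟩
  a ÷₀ b * (b ÷₀ D′)     ∎)
  where open ≤-Reasoning

open +-*-Solver

4*≤3*⇒≤¾* : ∀ {a b} → 4 ℕ.* a ℕ.≤ 3 ℕ.* b → ℕ→ℚ a ≤ + 3 / 4 * ℕ→ℚ b
4*≤3*⇒≤¾* {a} {b} 4a≤3b = begin
  ℕ→ℚ a                          ≡⟨ solve 1 (λ x → x := con (+ 1 / 4) :* (con (ℕ→ℚ 4) :* x)) refl (ℕ→ℚ a) ⟩
  + 1 / 4 * (ℕ→ℚ 4 * ℕ→ℚ a)     ≡⟨ cong (+ 1 / 4 *_) (sym (ℕ→ℚ-homo-* 4 a)) ⟩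
  + 1 / 4 * ℕ→ℚ (4 ℕ.* a)       ≤⟨ *-monoˡ-≤-nonNeg (+ 1 / 4) (ℕ→ℚ-mono-≤ 4a≤3b) ⟩
  + 1 / 4 * ℕ→ℚ (3 ℕ.* b)       ≡⟨ cong (+ 1 / 4 *_) (ℕ→ℚ-homo-* 3 b) ⟩
  + 1 / 4 * (ℕ→ℚ 3 * ℕ→ℚ b)
    ≡⟨ solve 1 (λ x → con (+ 1 / 4) :* (con (ℕ→ℚ 3) :* x) := con (+ 3 / 4) :* x) refl (ℕ→ℚ b) ⟩
  + 3 / 4 * ℕ→ℚ b               ∎
  where open ≤-Reasoning

-p≤∣p∣ : ∀ p → - p ≤ ∣ p ∣
-p≤∣p∣ p with ∣p∣≡p∨∣p∣≡-p p
... | inj₁ ∣p∣≡p = ≤-trans (neg-antimono-≤ (∣p∣≡p⇒0≤p ∣p∣≡p)) (0≤∣p∣ p)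
... | inj₂ ∣p∣≡-p = ≤-reflexive (sym ∣p∣≡-p)

≤¾⇒¼≤∣p-1∣ : ∀ {p} → p ≤ + 3 / 4 → + 1 / 4 ≤ ∣ p - 1ℚ ∣
≤¾⇒¼≤∣p-1∣ {p} p≤¾ = begin
  + 1 / 4            ≡⟨⟩
  1ℚ - + 3 / 4       ≤⟨ +-monoʳ-≤ 1ℚ (neg-antimono-≤ p≤¾) ⟩
  1ℚ - p             ≡⟨ solve 1 (λ x → con 1ℚ :- x := :- (x :- con 1ℚ)) refl p ⟩
  - (p - 1ℚ)         ≤⟨ -p≤∣p∣ (p - 1ℚ) ⟩
  ∣ p - 1ℚ ∣         ∎
  where open ≤-Reasoning

open Binomial using (nCk>0; 4*[k*nCc]≤3*[n+k]C[c+1])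
open Quotient using ([k+3]*[1+c]≤3*[1+n]; n∸c≡r+c*d; 1≤n∸c; n+k≡r+[1+c]*k; r*[c+2]*[r+c*d]≤r*[c+1]*[r+[c+1]*d])

mmsDenominator : ℕ → ℕ → ℕ → ℕ → ℚ
mmsDenominator n k c r = ℕ→ℚ (k ℕ.∸ r) + ℕ→ℚ (r ℕ.* (c ℕ.+ 1)) ÷₀ ℕ→ℚ (n ℕ.∸ c)

mmsDenominator-pos : ∀ {n d c r} → n ≡ r ℕ.+ c ℕ.* suc d → r ℕ.≤ d → 1 ℕ.≤ c → 1 ℕ.≤ d →
  0ℚ < mmsDenominator n (suc d) c r
mmsDenominator-pos {n} {d} {c} {r} n≡ r≤d 1≤c 1≤d =
  +-mono-<-≤ (ℕ→ℚ-pos (ℕ.m<n⇒0<n∸m (s≤s r≤d)))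
             (÷₀-nonNeg (ℕ→ℚ-nonNeg (r ℕ.* (c ℕ.+ 1))) (ℕ→ℚ-pos (1≤n∸c {n} {d} {c} {r} n≡ 1≤c 1≤d)))

mmsDenominator-shift-≤ : ∀ {n d c r} → n ≡ r ℕ.+ c ℕ.* suc d → r ℕ.≤ d → 1 ℕ.≤ c → 1 ℕ.≤ d →
  mmsDenominator (n ℕ.+ suc d) (suc d) (suc c) r ≤ mmsDenominator n (suc d) c r
mmsDenominator-shift-≤ {n} {d} {c} {r} n≡ r≤d 1≤c 1≤d =
  +-monoʳ-≤ (ℕ→ℚ (suc d ℕ.∸ r)) (*≤*⇒÷₀≤÷₀ 0<n+k∸[1+c] 0<n∸c (begin
    ℕ→ℚ (r ℕ.* (suc c ℕ.+ 1)) * ℕ→ℚ (n ℕ.∸ c)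
      ≡⟨ sym (ℕ→ℚ-homo-* (r ℕ.* (suc c ℕ.+ 1)) (n ℕ.∸ c)) ⟩
    ℕ→ℚ (r ℕ.* (suc c ℕ.+ 1) ℕ.* (n ℕ.∸ c))
      ≤⟨ ℕ→ℚ-mono-≤ cross ⟩
    ℕ→ℚ (r ℕ.* (c ℕ.+ 1) ℕ.* (n ℕ.+ suc d ℕ.∸ suc c))
      ≡⟨ ℕ→ℚ-homo-* (r ℕ.* (c ℕ.+ 1)) (n ℕ.+ suc d ℕ.∸ suc c) ⟩
    ℕ→ℚ (r ℕ.* (c ℕ.+ 1)) * ℕ→ℚ (n ℕ.+ suc d ℕ.∸ suc c) ∎))
  where
  open ≤-Reasoning
  n+k≡ : n ℕ.+ suc d ≡ r ℕ.+ suc c ℕ.* suc d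
  n+k≡ = n+k≡r+[1+c]*k {n} {suc d} {c} {r} n≡
  0<n∸c : 0ℚ < ℕ→ℚ (n ℕ.∸ c)
  0<n∸c = ℕ→ℚ-pos (1≤n∸c {n} {d} {c} {r} n≡ 1≤c 1≤d)
  0<n+k∸[1+c] : 0ℚ < ℕ→ℚ (n ℕ.+ suc d ℕ.∸ suc c)
  0<n+k∸[1+c] = ℕ→ℚ-pos (1≤n∸c {d = d} {suc c} {r} n+k≡ (s≤s z≤n) 1≤d)
  cross : r ℕ.* (suc c ℕ.+ 1) ℕ.* (n ℕ.∸ c) ℕ.≤ r ℕ.* (c ℕ.+ 1) ℕ.* (n ℕ.+ suc d ℕ.∸ suc c)
  cross rewrite n∸c≡r+c*d {n} {d} {c} {r} n≡ | n∸c≡r+c*d {d = d} {suc c} {r} n+k≡ =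
    r*[c+2]*[r+c*d]≤r*[c+1]*[r+[c+1]*d] c r≤d

mmsRatio≤¾ : ∀ {n d c r} → n ≡ r ℕ.+ c ℕ.* suc d → r ℕ.≤ d → 1 ℕ.≤ c → 2 ℕ.≤ d →
  (ℕ→ℚ (suc d) * (ℕ→ℚ (n C c) ÷₀ mmsDenominator n (suc d) c r))
    ÷₀ (ℕ→ℚ ((n ℕ.+ suc d) C suc c) ÷₀ mmsDenominator (n ℕ.+ suc d) (suc d) (suc c) r)
  ≤ + 3 / 4
mmsRatio≤¾ {n} {d} {c} {r} n≡ r≤d 1≤c 2≤d = begin
  (k * (A ÷₀ D)) ÷₀ (B ÷₀ D′)   ≡⟨ cong (_÷₀ (B ÷₀ D′)) (*-÷₀-assoc k A D) ⟩
  ((k * A) ÷₀ D) ÷₀ (B ÷₀ D′)   ≤⟨ ÷₀-÷₀-≤ 0≤kA 0<B 0<D′ D′≤D ⟩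
  (k * A) ÷₀ B                  ≤⟨ ≤*⇒÷₀≤ 0<B kA≤¾B ⟩
  + 3 / 4                       ∎
  where
  open ≤-Reasoning
  k A B D D′ : ℚ
  k = ℕ→ℚ (suc d)
  A = ℕ→ℚ (n C c)
  B = ℕ→ℚ ((n ℕ.+ suc d) C suc c)
  D = mmsDenominator n (suc d) c r
  D′ = mmsDenominator (n ℕ.+ suc d) (suc d) (suc c) r
  1≤d : 1 ℕ.≤ d
  1≤d = ℕ.≤-trans (ℕ.n≤1+n 1) 2≤d
  c≤n : c ℕ.≤ n
  c≤n = ℕ.≤-trans (ℕ.m≤m*n c (suc d)) (ℕ.≤-trans (ℕ.m≤n+m (c ℕ.* suc d) r) (ℕ.≤-reflexive (sym n≡)))
  0<B : 0ℚ < B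
  0<B = ℕ→ℚ-pos (nCk>0 (ℕ.≤-trans (s≤s (ℕ.≤-trans c≤n (ℕ.m≤m+n n d))) (ℕ.≤-reflexive (sym (ℕ.+-suc n d)))))
  0<D′ : 0ℚ < D′
  0<D′ = mmsDenominator-pos (n+k≡r+[1+c]*k {n} {suc d} {c} {r} n≡) r≤d (s≤s z≤n) 1≤d
  D′≤D : D′ ≤ D
  D′≤D = mmsDenominator-shift-≤ n≡ r≤d 1≤c 1≤d
  0≤kA : 0ℚ ≤ k * A
  0≤kA = subst (0ℚ ≤_) (ℕ→ℚ-homo-* (suc d) (n C c)) (ℕ→ℚ-nonNeg (suc d ℕ.* (n C c)))
  kA≤¾B : k * A ≤ + 3 / 4 * B
  kA≤¾B = subst (_≤ + 3 / 4 * B) (ℕ→ℚ-homo-* (suc d) (n C c))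
    (4*≤3*⇒≤¾* {suc d ℕ.* (n C c)} {(n ℕ.+ suc d) C suc c}
      (4*[k*nCc]≤3*[n+k]C[c+1] {n} {suc d} {c}
        ([k+3]*[1+c]≤3*[1+n] {n} {suc d} {c} {r} (s≤s 2≤d) 1≤c n≡)))

MMS[n+k]≡ : ∀ n d → MMS (n ℕ.+ suc d) (suc d)
  ≡ ℕ→ℚ ((n ℕ.+ suc d) C suc (n ℕ./ suc d))
      ÷₀ mmsDenominator (n ℕ.+ suc d) (suc d) (suc (n ℕ./ suc d)) (n % suc d)
MMS[n+k]≡ n d = cong₂ (λ c r → ℕ→ℚ ((n ℕ.+ suc d) C c) ÷₀ mmsDenominator (n ℕ.+ suc d) (suc d) c r)
  (trans (m/n≡1+[m∸n]/n (ℕ.m≤n+m (suc d) n)) (cong (λ m → suc (m ℕ./ suc d)) (ℕ.m+n∸n≡m n (suc d))))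
  ([m+n]%n≡m%n n (suc d))

k*MMS/MMS≤¾ : ∀ n k → 3 ℕ.≤ k → k ℕ.≤ n → (ℕ→ℚ k * MMS n k) ÷₀ MMS (n ℕ.+ k) k ≤ + 3 / 4
k*MMS/MMS≤¾ n (suc d) (s≤s 2≤d) k≤n rewrite MMS[n+k]≡ n d =
  mmsRatio≤¾ (m≡m%n+[m/n]*n n (suc d)) (ℕ.≤-pred (m%n<n n (suc d))) (m≥n⇒m/n>0 k≤n) 2≤d

lemma6 : (n k : ℕ → ℕ)
       → (∀ j → 3 ℕ.≤ k j × k j ℕ.≤ n j)
       → (∀ M → ∃[ N ] (∀ j → N ℕ.≤ j → M ℕ.≤ n j))
       → ¬ (∀ (ε : ℚ) → 0ℚ ℚ.< ε →
              ∃[ N ] (∀ j → N ℕ.≤ j →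
                ∣ ((ℕ→ℚ (k j) ℚ.* MMS (n j) (k j)) ÷₀ MMS (n j ℕ.+ k j) (k j)) - 1ℚ ∣ ℚ.< ε))
lemma6 n k bounds _ converges with converges (+ 1 / 4) (*<* (+<+ (s≤s z≤n)))
... | N , close = <-irrefl refl (<-≤-trans (close N ℕ.≤-refl) ¼≤∣X-1∣)
  where
  ¼≤∣X-1∣ : + 1 / 4 ≤ ∣ (ℕ→ℚ (k N) * MMS (n N) (k N)) ÷₀ MMS (n N ℕ.+ k N) (k N) - 1ℚ ∣
  ¼≤∣X-1∣ = ≤¾⇒¼≤∣p-1∣ (k*MMS/MMS≤¾ (n N) (k N) (proj₁ (bounds N)) (proj₂ (bounds N)))
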